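{- Let $n,r\geq 1$ and let $\mathcal{A}\subseteq\mathcal{I}^{(r)}(K_n^*)$ be an intersecting family. Then there exists an intersecting family $\mathcal{B}\subseteq\mathcal{I}^{(r)}(K_n^*)$ such that (1) $|\mathcal{A}|=|\mathcal{B}|$, and (2) for all $B_1,B_2\in\mathcal{B}$, $B_1\cap B_2\not\subseteq\{x_1,\dots,x_n\}=V(K_n)$.
   Context: $K_n$ is the complete graph on vertices $x_1,\dots,x_n$. The pendant graph $K_n^*$ has vertex set $\{x_1,\dots,x_n\}\sqcup\{p_1,\dots,p_n\}$ and edge set $E(K_n)\sqcup\{x_1p_1,\dots,x_np_n\}$. $\mathcal{I}^{(r)}(H)$ denotes the family of independent sets of size $r$ in a graph $H$. A family of sets is intersecting if every two of its members have nonempty intersection. -}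

module Defs where

open import Data.Nat using (ℕ; _+_)
open import Data.Fin using (Fin)
open import Data.Fin.Subset using (Subset; _∈_; ∣_∣)
open import Data.Sum using (_⊎_; inj₁; inj₂)
open import Data.Product using (_×_; _,_; ∃)
open import Data.Empty using (⊥)
open import Data.Unit using (⊤)
open import Data.List using (List)
open import Data.List.Relation.Unary.All using (All)
open import Data.List.Relation.Unary.Unique.Propositional using (Unique)
import Data.List.Membership.Propositional as LM
open import Relation.Binary.PropositionalEquality using (_≡_; _≢_)
open import Relation.Nullary using (¬_)

-- Vertices of the pendant graph K_n^*: inj₁ i = x_i (core), inj₂ i = p_i (pendant).
V : ℕ → Set
V n = Fin n ⊎ Fin n

Adj : ∀ {n} → V n → V n → Set
Adj (inj₁ i) (inj₁ j) = i ≢ j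
Adj (inj₁ i) (inj₂ j) = i ≡ j
Adj (inj₂ i) (inj₁ j) = i ≡ j
Adj (inj₂ i) (inj₂ j) = ⊥

VSet : ℕ → Set
VSet n = Subset n × Subset n

_∈V_ : ∀ {n} → V n → VSet n → Set
inj₁ i ∈V (X , P) = i ∈ X
inj₂ i ∈V (X , P) = i ∈ P

size : ∀ {n} → VSet n → ℕ
size (X , P) = ∣ X ∣ + ∣ P ∣

Independent : ∀ {n} → VSet n → Set
Independent {n} S = ∀ (u v : V n) → u ∈V S → v ∈V S → ¬ Adj u v

IndepOfSize : ∀ {n} → ℕ → VSet n → Set
IndepOfSize r S = Independent S × size S ≡ r

-- A family of subsets: a duplicate-free list; its cardinality is its length.
Family : ℕ → Set
Family n = List (VSet n)

IsFamily : ∀ {n} → Family n → Set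
IsFamily F = Unique F

FamilyOfIndep : ∀ {n} → ℕ → Family n → Set
FamilyOfIndep r F = All (IndepOfSize r) F

Intersecting : ∀ {n} → Family n → Set
Intersecting {n} F = ∀ A B → A LM.∈ F → B LM.∈ F → ∃ λ (v : V n) → v ∈V A × v ∈V B

IsCore : ∀ {n} → V n → Set
IsCore (inj₁ _) = ⊤
IsCore (inj₂ _) = ⊥

InterNotInCore : ∀ {n} → VSet n → VSet n → Set
InterNotInCore {n} B₁ B₂ = ¬ (∀ (v : V n) → v ∈V B₁ → v ∈V B₂ → IsCore v)

module Submission where

-- Compress along the shifts x_i ↦ p_i: for each i, replace every A ∋ x_i by A − x_i + p_i unless that
-- set is already in the family. This is injective on the family and keeps sizes and independence; it keeps
-- the family intersecting because if A moves, B stays and A ∩ B = {x_i}, then B − x_i + p_i is in the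
-- family and meets A outside {x_i, p_i}. Once compressed at every i the family is closed under all shifts.
-- So if B₁ ∩ B₂ ⊆ V(K_n), say x_i ∈ B₁ ∩ B₂, the shift of B₁ meets B₂; as B₂ is independent and
-- contains x_i, the common vertex is a pendant p_k with k ≠ i, which already lies in B₁ ∩ B₂.

open import Defs
open import Data.Nat using (ℕ; _≥_; suc; _+_)
open import Data.Nat.Properties using (+-suc)
open import Data.Bool using (true; false)
open import Data.Bool.Properties using (¬-not) renaming (_≟_ to _≟ᵇ_)
open import Data.Fin using (Fin; zero; suc; _≟_)
open import Data.Fin.Subset using (Subset; ∣_∣; inside; outside)
open import Data.Fin.Subset.Properties using () renaming (_∈?_ to _∈ˢ?_)
open import Data.Vec using (Vec; _∷_; lookup; _[_]≔_; _[_]=_)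
open import Data.Vec.Properties as Vecₚ
  using ([]=-injective; []=⇒lookup; lookup⇒[]=; lookup∘update′; []≔-updates; []≔-minimal; []≔-idempotent; []≔-lookup)
open import Data.Sum using (inj₁; inj₂)
open import Data.Product using (_×_; _,_; proj₁; proj₂; ∃)
import Data.Product.Properties as Productₚ
import Data.Sum.Properties as Sumₚ
open import Data.List using (List; []; _∷_; map; length; allFin)
open import Data.List.Properties using (length-map)
open import Data.List.Relation.Unary.All as All using (All)
import Data.List.Relation.Unary.All.Properties as Allₚ
open import Data.List.Relation.Unary.AllPairs using ([]; _∷_)
open import Data.List.Relation.Unary.Any using (here; there)
open import Data.List.Relation.Unary.Unique.Propositional using (Unique)
import Data.List.Membership.Propositional as LM
open LM using (_∈_; _∉_)
open import Data.List.Membership.Propositional.Properties using (∈-map⁺; ∈-map⁻; ∈-allFin)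
import Data.List.Membership.DecPropositional as DecMembership
open import Relation.Binary.PropositionalEquality using (_≡_; _≢_; refl; sym; trans; cong; cong₂; subst; module ≡-Reasoning)
open import Relation.Binary.Definitions using (DecidableEquality)
open import Function using (_∘_)
open import Relation.Nullary using (¬_; yes; no; contradiction)
open import Relation.Nullary.Decidable using (_×-dec_; ¬?)
open import Relation.Unary using (Decidable)

[]≔-minimal⁻ : ∀ {A : Set} {n} (xs : Vec A n) {i j : Fin n} {x y : A} →
  i ≢ j → (xs [ j ]≔ y) [ i ]= x → xs [ i ]= x
[]≔-minimal⁻ xs {i} {j} {y = y} i≢j h =
  lookup⇒[]= i xs (trans (sym (lookup∘update′ i≢j xs y)) ([]=⇒lookup h))

[]≔-cancel : ∀ {A : Set} {n} (xs ys : Vec A n) (i : Fin n) {x : A} →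
  lookup xs i ≡ lookup ys i → xs [ i ]≔ x ≡ ys [ i ]≔ x → xs ≡ ys
[]≔-cancel xs ys i {x} xsᵢ≡ysᵢ eq = begin
  xs                                 ≡⟨ restore xs ⟨
  (xs [ i ]≔ x) [ i ]≔ lookup xs i   ≡⟨ cong₂ (λ zs z → zs [ i ]≔ z) eq xsᵢ≡ysᵢ ⟩
  (ys [ i ]≔ x) [ i ]≔ lookup ys i   ≡⟨ restore ys ⟩
  ys                                 ∎
  where
  open ≡-Reasoning
  restore : ∀ zs → (zs [ i ]≔ x) [ i ]≔ lookup zs i ≡ zs
  restore zs = trans ([]≔-idempotent zs i) ([]≔-lookup zs i)

∣p[x]≔inside∣≡1+∣p[x]≔outside∣ : ∀ {n} (p : Subset n) (x : Fin n) →
  ∣ p [ x ]≔ inside ∣ ≡ suc ∣ p [ x ]≔ outside ∣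
∣p[x]≔inside∣≡1+∣p[x]≔outside∣ (b ∷ p) zero = refl
∣p[x]≔inside∣≡1+∣p[x]≔outside∣ (true ∷ p) (suc x) = cong suc (∣p[x]≔inside∣≡1+∣p[x]≔outside∣ p x)
∣p[x]≔inside∣≡1+∣p[x]≔outside∣ (false ∷ p) (suc x) = ∣p[x]≔inside∣≡1+∣p[x]≔outside∣ p x

unique-map⁺ : ∀ {A B : Set} (f : A → B) {xs : List A} →
  (∀ {x y} → x ∈ xs → y ∈ xs → f x ≡ f y → x ≡ y) → Unique xs → Unique (map f xs)
unique-map⁺ f inj [] = []
unique-map⁺ f inj (x∉xs ∷ xs!) =
  Allₚ.map⁺ (All.tabulate (λ y∈xs fx≡fy → All.lookup x∉xs y∈xs (inj (here refl) (there y∈xs) fx≡fy)))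
  ∷ unique-map⁺ f (λ x∈ y∈ → inj (there x∈) (there y∈)) xs!

module Compression {X : Set} (_≟ˣ_ : DecidableEquality X) {D : X → Set} (D? : Decidable D) (s : X → X)
  (s-injective : ∀ {A B} → D A → D B → s A ≡ s B → A ≡ B) (s-leaves : ∀ A → ¬ D (s A)) where

  open DecMembership _≟ˣ_ using (_∈?_)

  Stable : List X → Set
  Stable 𝒜 = ∀ {A} → A ∈ 𝒜 → D A → s A ∈ 𝒜

  module _ (𝒜 : List X) where

    Moves : X → Set
    Moves A = D A × s A ∉ 𝒜

    moves? : Decidable Moves
    moves? A = D? A ×-dec ¬? (s A ∈? 𝒜)

    step : X → X
    step A with moves? A
    ... | yes _ = s A
    ... | no _ = A

    staying⇒s∈ : ∀ {A} → ¬ Moves A → D A → s A ∈ 𝒜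
    staying⇒s∈ {A} stays dA with s A ∈? 𝒜
    ... | yes s∈ = s∈
    ... | no s∉ = contradiction (dA , s∉) stays

  compress : List X → List X
  compress 𝒜 = map (step 𝒜) 𝒜

  data CompressedFrom (𝒜 : List X) : X → Set where
    moved  : ∀ {A} → A ∈ 𝒜 → Moves 𝒜 A → CompressedFrom 𝒜 (s A)
    stayed : ∀ {A} → A ∈ 𝒜 → ¬ Moves 𝒜 A → CompressedFrom 𝒜 A

  ∈-compress⁻ : ∀ {𝒜 A′} → A′ ∈ compress 𝒜 → CompressedFrom 𝒜 A′
  ∈-compress⁻ {𝒜} A′∈ with ∈-map⁻ (step 𝒜) A′∈
  ... | A , A∈ , refl with moves? 𝒜 A
  ...   | yes m = moved A∈ m
  ...   | no m = stayed A∈ m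

  ∈-compress⁺ : ∀ {𝒜 A} → A ∈ 𝒜 → ¬ D A → A ∈ compress 𝒜
  ∈-compress⁺ {𝒜} {A} A∈ ¬dA with moves? 𝒜 A | ∈-map⁺ (step 𝒜) A∈
  ... | yes (dA , _) | _ = contradiction dA ¬dA
  ... | no _ | A∈′ = A∈′

  compress-length : ∀ 𝒜 → length (compress 𝒜) ≡ length 𝒜
  compress-length 𝒜 = length-map (step 𝒜) 𝒜

  step-injective : ∀ {𝒜 A B} → A ∈ 𝒜 → B ∈ 𝒜 → step 𝒜 A ≡ step 𝒜 B → A ≡ B
  step-injective {𝒜} {A} {B} A∈ B∈ eq with moves? 𝒜 A | moves? 𝒜 B
  ... | yes (dA , _) | yes (dB , _) = s-injective dA dB eq
  ... | yes (_ , sA∉) | no _ = contradiction (subst (_∈ 𝒜) (sym eq) B∈) sA∉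
  ... | no _ | yes (_ , sB∉) = contradiction (subst (_∈ 𝒜) eq A∈) sB∉
  ... | no _ | no _ = eq

  compress-unique : ∀ {𝒜} → Unique 𝒜 → Unique (compress 𝒜)
  compress-unique {𝒜} = unique-map⁺ (step 𝒜) step-injective

  compress-all : ∀ {P : X → Set} {𝒜} → (∀ {A} → D A → P A → P (s A)) → All P 𝒜 → All P (compress 𝒜)
  compress-all {P} {𝒜} s-pres ps = Allₚ.map⁺ (All.map step-pres ps)
    where
    step-pres : ∀ {A} → P A → P (step 𝒜 A)
    step-pres {A} pA with moves? 𝒜 A
    ... | yes (dA , _) = s-pres dA pA
    ... | no _ = pA

  compress-stable : ∀ 𝒜 → Stable (compress 𝒜)
  compress-stable 𝒜 A′∈ dA′ with ∈-compress⁻ A′∈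
  ... | moved {A} _ _ = contradiction dA′ (s-leaves A)
  ... | stayed {A} _ stays = ∈-compress⁺ (staying⇒s∈ 𝒜 stays dA′) (s-leaves A)

module _ {n : ℕ} where

  shift : Fin n → VSet n → VSet n
  shift i (X , P) = X [ i ]≔ outside , P [ i ]≔ inside

  Shiftable : Fin n → VSet n → Set
  Shiftable i A = inj₁ i ∈V A × ¬ inj₂ i ∈V A

  Meets : VSet n → VSet n → Set
  Meets A B = ∃ λ (v : V n) → v ∈V A × v ∈V B

  _≟V_ : DecidableEquality (V n)
  _≟V_ = Sumₚ.≡-dec _≟_ _≟_

  _≟VSet_ : DecidableEquality (VSet n)
  _≟VSet_ = Productₚ.≡-dec (Vecₚ.≡-dec _≟ᵇ_) (Vecₚ.≡-dec _≟ᵇ_)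

  x∉shift : ∀ i A → ¬ inj₁ i ∈V shift i A
  x∉shift i (X , P) h with () ← []=-injective h ([]≔-updates X i)

  p∈shift : ∀ i A → inj₂ i ∈V shift i A
  p∈shift i (X , P) = []≔-updates P i

  ∈-shift⁺ : ∀ i A v → v ∈V A → v ≢ inj₁ i → v ∈V shift i A
  ∈-shift⁺ i (X , P) (inj₁ j) h v≢xᵢ = []≔-minimal X j i (λ j≡i → v≢xᵢ (cong inj₁ j≡i)) h
  ∈-shift⁺ i (X , P) (inj₂ j) h _ with j ≟ i
  ... | yes refl = []≔-updates P i
  ... | no j≢i = []≔-minimal P j i j≢i h

  ∈-shift⁻ : ∀ i A v → v ∈V shift i A → v ≢ inj₂ i → v ∈V A
  ∈-shift⁻ i A@(X , P) (inj₁ j) h _ with j ≟ i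
  ... | yes refl = contradiction h (x∉shift i A)
  ... | no j≢i = []≔-minimal⁻ X j≢i h
  ∈-shift⁻ i (X , P) (inj₂ j) h v≢pᵢ = []≔-minimal⁻ P (λ j≡i → v≢pᵢ (cong inj₂ j≡i)) h

  shift-injective : ∀ {i A B} → Shiftable i A → Shiftable i B → shift i A ≡ shift i B → A ≡ B
  shift-injective {i} {X , P} {Y , Q} (xᵢ∈A , pᵢ∉A) (xᵢ∈B , pᵢ∉B) eq =
    cong₂ _,_ ([]≔-cancel X Y i (trans ([]=⇒lookup xᵢ∈A) (sym ([]=⇒lookup xᵢ∈B))) (cong proj₁ eq))
              ([]≔-cancel P Q i (trans (∉⇒false P pᵢ∉A) (sym (∉⇒false Q pᵢ∉B))) (cong proj₂ eq))
    where
    ∉⇒false : ∀ R → ¬ R [ i ]= true → lookup R i ≡ false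
    ∉⇒false R i∉R = ¬-not (λ e → i∉R (lookup⇒[]= i R e))

  Independent⇒core-unique : ∀ {A : VSet n} {i j} → Independent A → inj₁ i ∈V A → inj₁ j ∈V A → i ≡ j
  Independent⇒core-unique {i = i} {j} ind xᵢ∈A xⱼ∈A with i ≟ j
  ... | yes i≡j = i≡j
  ... | no i≢j = contradiction i≢j (ind (inj₁ i) (inj₁ j) xᵢ∈A xⱼ∈A)

  Independent⇒shiftable : ∀ {A : VSet n} {i} → Independent A → inj₁ i ∈V A → Shiftable i A
  Independent⇒shiftable {i = i} ind xᵢ∈A = xᵢ∈A , λ pᵢ∈A → ind (inj₁ i) (inj₂ i) xᵢ∈A pᵢ∈A refl

  coreless⇒Independent : ∀ {S : VSet n} → (∀ j → ¬ inj₁ j ∈V S) → Independent S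
  coreless⇒Independent noCore (inj₁ j) _ xⱼ∈S _ _ = noCore j xⱼ∈S
  coreless⇒Independent noCore (inj₂ j) (inj₁ k) _ xₖ∈S _ = noCore k xₖ∈S
  coreless⇒Independent noCore (inj₂ j) (inj₂ k) _ _ ()

  size-shift : ∀ {i} A → Shiftable i A → size (shift i A) ≡ size A
  size-shift {i} (X , P) (xᵢ∈X , pᵢ∉P) = begin
    ∣ X [ i ]≔ outside ∣ + ∣ P [ i ]≔ inside ∣
      ≡⟨ cong (∣ X [ i ]≔ outside ∣ +_) (∣p[x]≔inside∣≡1+∣p[x]≔outside∣ P i) ⟩
    ∣ X [ i ]≔ outside ∣ + suc ∣ P [ i ]≔ outside ∣
      ≡⟨ +-suc _ _ ⟩
    suc ∣ X [ i ]≔ outside ∣ + ∣ P [ i ]≔ outside ∣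
      ≡⟨ cong (_+ ∣ P [ i ]≔ outside ∣) (∣p[x]≔inside∣≡1+∣p[x]≔outside∣ X i) ⟨
    ∣ X [ i ]≔ inside ∣ + ∣ P [ i ]≔ outside ∣
      ≡⟨ cong₂ (λ Y Q → ∣ Y ∣ + ∣ Q ∣) (restore X inside ([]=⇒lookup xᵢ∈X)) (restore P outside pᵢ∉P′) ⟩
    ∣ X ∣ + ∣ P ∣
      ∎
    where
    open ≡-Reasoning
    pᵢ∉P′ : lookup P i ≡ outside
    pᵢ∉P′ = ¬-not (λ e → pᵢ∉P (lookup⇒[]= i P e))
    restore : ∀ R b → lookup R i ≡ b → R [ i ]≔ b ≡ R
    restore R b refl = []≔-lookup R i

  shift-independent : ∀ {i A} → Independent A → Shiftable i A → Independent (shift i A)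
  shift-independent {i} {A} ind (xᵢ∈A , _) = coreless⇒Independent noCore
    where
    noCore : ∀ j → ¬ inj₁ j ∈V shift i A
    noCore j xⱼ∈sA with Independent⇒core-unique ind (∈-shift⁻ i A (inj₁ j) xⱼ∈sA λ ()) xᵢ∈A
    ... | refl = x∉shift i A xⱼ∈sA

  shift-indepOfSize : ∀ {r i A} → Shiftable i A → IndepOfSize r A → IndepOfSize r (shift i A)
  shift-indepOfSize {A = A} dA (ind , size≡r) = shift-independent ind dA , trans (size-shift A dA) size≡r

  shiftable? : ∀ i → Decidable (Shiftable i)
  shiftable? i A = (i ∈ˢ? proj₁ A) ×-dec ¬? (i ∈ˢ? proj₂ A)

module ShiftCompression {n : ℕ} (i : Fin n) =
  Compression _≟VSet_ (shiftable? i) (shift i) shift-injective (λ A → x∉shift i A ∘ proj₁)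
open ShiftCompression

record IntersectingIndepFamily {n : ℕ} (r : ℕ) (𝒜 : Family n) : Set where
  field
    unique       : IsFamily 𝒜
    independent  : FamilyOfIndep r 𝒜
    intersecting : Intersecting 𝒜

member-independent : ∀ {n r} {𝒜 : Family n} {A} → FamilyOfIndep r 𝒜 → A ∈ 𝒜 → Independent A
member-independent indep A∈ = proj₁ (All.lookup indep A∈)

module _ {n : ℕ} {r : ℕ} {𝒜 : Family n} (indep : FamilyOfIndep r 𝒜) where

  moved-meets-stayed : ∀ {i A B} → Intersecting 𝒜 → A ∈ 𝒜 → B ∈ 𝒜 →
    Shiftable i A → ¬ Moves i 𝒜 B → Meets (shift i A) B
  moved-meets-stayed {i} {A} {B} meet A∈ B∈ (_ , pᵢ∉A) stays with meet A B A∈ B∈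
  ... | v , v∈A , v∈B with v ≟V inj₁ i
  ...   | no v≢xᵢ = v , ∈-shift⁺ i A v v∈A v≢xᵢ , v∈B
  ...   | yes refl
          with meet A (shift i B) A∈ (staying⇒s∈ i 𝒜 stays (Independent⇒shiftable (member-independent indep B∈) v∈B))
  ...     | w , w∈A , w∈sB = w , ∈-shift⁺ i A w w∈A w≢xᵢ , ∈-shift⁻ i B w w∈sB w≢pᵢ
    where
    w≢xᵢ : w ≢ inj₁ i
    w≢xᵢ refl = x∉shift i B w∈sB
    w≢pᵢ : w ≢ inj₂ i
    w≢pᵢ refl = pᵢ∉A w∈A

  compress-intersecting : ∀ {i} → Intersecting 𝒜 → Intersecting (compress i 𝒜)
  compress-intersecting {i} meet A′ B′ A′∈ B′∈ with ∈-compress⁻ i A′∈ | ∈-compress⁻ i B′∈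
  ... | moved {A} _ _ | moved {B} _ _ = inj₂ i , p∈shift i A , p∈shift i B
  ... | moved A∈ (dA , _) | stayed B∈ stays = moved-meets-stayed meet A∈ B∈ dA stays
  ... | stayed A∈ stays | moved B∈ (dB , _) with moved-meets-stayed meet B∈ A∈ dB stays
  ...   | v , v∈sB , v∈A = v , v∈A , v∈sB
  compress-intersecting meet A′ B′ A′∈ B′∈
      | stayed A∈ _ | stayed B∈ _ = meet A′ B′ A∈ B∈

  compress-stable-other : ∀ {i j} → j ≢ i → Stable j 𝒜 → Stable j (compress i 𝒜)
  compress-stable-other {i} {j} j≢i stable A′∈ dA′@(xⱼ∈A′ , _) with ∈-compress⁻ i A′∈
  ... | moved {A} A∈ ((xᵢ∈A , _) , _) =
        contradiction
          (Independent⇒core-unique (member-independent indep A∈) (∈-shift⁻ i A (inj₁ j) xⱼ∈A′ λ ()) xᵢ∈A) j≢i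
  ... | stayed {A} A∈ _ = ∈-compress⁺ i (stable A∈ dA′) ¬dsA
    where
    ¬dsA : ¬ Shiftable i (shift j A)
    ¬dsA (xᵢ∈sA , _) =
      contradiction
        (Independent⇒core-unique (member-independent indep A∈) xⱼ∈A′ (∈-shift⁻ j A (inj₁ i) xᵢ∈sA λ ())) j≢i

compressAll : ∀ {n} → List (Fin n) → Family n → Family n
compressAll []       𝒜 = 𝒜
compressAll (i ∷ is) 𝒜 = compress i (compressAll is 𝒜)

compressAll-length : ∀ {n} is (𝒜 : Family n) → length (compressAll is 𝒜) ≡ length 𝒜
compressAll-length []       𝒜 = refl
compressAll-length (i ∷ is) 𝒜 = trans (compress-length i (compressAll is 𝒜)) (compressAll-length is 𝒜)

module _ {n r : ℕ} where

  compress-intersectingIndep : ∀ i {𝒜 : Family n} →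
    IntersectingIndepFamily r 𝒜 → IntersectingIndepFamily r (compress i 𝒜)
  compress-intersectingIndep i fam = record
    { unique       = compress-unique i unique
    ; independent  = compress-all i shift-indepOfSize independent
    ; intersecting = compress-intersecting independent {i} intersecting
    }
    where open IntersectingIndepFamily fam

  compressAll-intersectingIndep : ∀ is {𝒜 : Family n} →
    IntersectingIndepFamily r 𝒜 → IntersectingIndepFamily r (compressAll is 𝒜)
  compressAll-intersectingIndep []       fam = fam
  compressAll-intersectingIndep (i ∷ is) fam = compress-intersectingIndep i (compressAll-intersectingIndep is fam)

  compressAll-stable : ∀ {i is} {𝒜 : Family n} → IntersectingIndepFamily r 𝒜 → i ∈ is → Stable i (compressAll is 𝒜)
  compressAll-stable {is = i ∷ is} {𝒜} fam (here refl) = compress-stable i (compressAll is 𝒜)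
  compressAll-stable {i} {j ∷ is} {𝒜} fam (there i∈is) with i ≟ j
  ... | yes refl = compress-stable i (compressAll is 𝒜)
  ... | no i≢j = compress-stable-other independent i≢j (compressAll-stable fam i∈is)
    where open IntersectingIndepFamily (compressAll-intersectingIndep is fam)

  stable⇒interNotInCore : ∀ {ℬ : Family n} → FamilyOfIndep r ℬ → Intersecting ℬ → (∀ i → Stable i ℬ) →
    ∀ {B₁ B₂} → B₁ ∈ ℬ → B₂ ∈ ℬ → InterNotInCore B₁ B₂
  stable⇒interNotInCore indep meet stable {B₁} {B₂} B₁∈ B₂∈ coreOnly with meet B₁ B₂ B₁∈ B₂∈
  ... | inj₂ j , pⱼ∈B₁ , pⱼ∈B₂ = coreOnly (inj₂ j) pⱼ∈B₁ pⱼ∈B₂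
  ... | inj₁ i , xᵢ∈B₁ , xᵢ∈B₂
        with meet (shift i B₁) B₂ (stable i B₁∈ (Independent⇒shiftable (member-independent indep B₁∈) xᵢ∈B₁)) B₂∈
  ...   | inj₁ k , xₖ∈sB₁ , xₖ∈B₂ with Independent⇒core-unique (member-independent indep B₂∈) xₖ∈B₂ xᵢ∈B₂
  ...     | refl = x∉shift i B₁ xₖ∈sB₁
  stable⇒interNotInCore indep meet stable {B₁} {B₂} B₁∈ B₂∈ coreOnly
      | inj₁ i , xᵢ∈B₁ , xᵢ∈B₂ | inj₂ k , pₖ∈sB₁ , pₖ∈B₂ =
        coreOnly (inj₂ k) (∈-shift⁻ i B₁ (inj₂ k) pₖ∈sB₁ pₖ≢pᵢ) pₖ∈B₂
    where
    pₖ≢pᵢ : inj₂ k ≢ inj₂ i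
    pₖ≢pᵢ refl = proj₂ (Independent⇒shiftable (member-independent indep B₂∈) xᵢ∈B₂) pₖ∈B₂

lemma3 : ∀ (n r : ℕ) → n ≥ 1 → r ≥ 1 → (𝒜 : Family n) → IsFamily 𝒜 → FamilyOfIndep r 𝒜 → Intersecting 𝒜 →
    ∃ λ (ℬ : Family n) → IsFamily ℬ × FamilyOfIndep r ℬ × Intersecting ℬ × length 𝒜 ≡ length ℬ ×
    (∀ B₁ B₂ → B₁ LM.∈ ℬ → B₂ LM.∈ ℬ → InterNotInCore B₁ B₂)
lemma3 n r _ _ 𝒜 𝒜-unique 𝒜-indep 𝒜-intersecting =
  ℬ , unique , independent , intersecting , sym (compressAll-length (allFin n) 𝒜) ,
  λ _ _ → stable⇒interNotInCore independent intersecting (λ i → compressAll-stable 𝒜-fam (∈-allFin i))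
  where
  ℬ : Family n
  ℬ = compressAll (allFin n) 𝒜
  𝒜-fam : IntersectingIndepFamily r 𝒜
  𝒜-fam = record { unique = 𝒜-unique ; independent = 𝒜-indep ; intersecting = 𝒜-intersecting }
  open IntersectingIndepFamily (compressAll-intersectingIndep (allFin n) 𝒜-fam)
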